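{- Let $n\ge 1$ and $k\ge 0$. The number of permutations $\pi\in S_n$ for which the number of blocks $b(\pi)$ (defined below) equals $k$ is $n\cdot c(n-1,k)$, where $c(n-1,k)$ is the signless Stirling number of the first kind (the number of permutations of $n-1$ letters with exactly $k$ cycles).
   Context: For $\pi\in S_n$ written as a word $\pi(1)\cdots\pi(n)$, append the letter $n+1$ at the right and write the resulting word as $\pi_L\cdot 1\cdot \pi_R'$, where $\pi_L$ is the (possibly empty) subword to the left of the letter $1$ and $\pi_R'$ is the subword to the right of $1$ (which ends with $n+1$); let $\pi_R$ be $\pi_R'$ with the final letter $n+1$ removed. Decompose $\pi_L$ into consecutive blocks $\pi_L=\pi_1\cdot\pi_2\cdots\pi_l$ as follows: $\pi_1$ is the prefix of $\pi_L$ ending at the largest letter of $\pi_L$; $\pi_2$ is the prefix of the remaining word ending at its largest letter; and so on until $\pi_L$ is exhausted ($l=0$ if $\pi_L$ is empty). Then $b(\pi)=l$ if $\pi_R$ is empty and $b(\pi)=l+1$ if $\pi_R$ is nonempty (i.e. the blocks are $\pi_1,\dots,\pi_l$ and $\pi_R$, disregarding the singleton block consisting of the minimum element $1$). -}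

module Defs where

open import Data.Nat using (ℕ; zero; suc; _+_; _*_; _≟_; _⊔_)
open import Data.List using (List; []; _∷_; map; concatMap; length; filter; upTo; foldr)
open import Data.List.Relation.Unary.Unique.DecPropositional _≟_ using (unique?)
open import Data.Product using (_×_; _,_; proj₁; proj₂)
open import Relation.Nullary.Decidable using (does)
open import Relation.Nullary using (yes; no)

-- Permutations of {1,…,n} as words π(1)⋯π(n).
-- letters n = [1, …, n]
letters : ℕ → List ℕ
letters n = map suc (upTo n)

words : ℕ → ℕ → List (List ℕ)
words n zero    = [] ∷ []
words n (suc m) = concatMap (λ x → map (x ∷_) (words n m)) (letters n)

perms : ℕ → List (List ℕ)
perms n = filter unique? (words n n)

splitAt1 : List ℕ → List ℕ × List ℕ
splitAt1 []      = [] , []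
splitAt1 (x ∷ xs) with x ≟ 1
... | yes _ = [] , xs
... | no  _ = let r = splitAt1 xs in (x ∷ proj₁ r) , proj₂ r

maxL : List ℕ → ℕ
maxL = foldr _⊔_ 0

splitAfter : ℕ → List ℕ → List ℕ × List ℕ
splitAfter m []       = [] , []
splitAfter m (x ∷ xs) with x ≟ m
... | yes _ = (x ∷ []) , xs
... | no  _ = let r = splitAfter m xs in (x ∷ proj₁ r) , proj₂ r

-- block decomposition π_L = π_1 ⋯ π_l : π_1 is the prefix ending at the
-- largest letter, then recurse on the rest (fuel = length of the word,
-- which always suffices since each step removes at least one letter)
blocksF : ℕ → List ℕ → List (List ℕ)
blocksF zero     w        = []
blocksF (suc f)  []       = []
blocksF (suc f)  (x ∷ xs) =
  let r = splitAfter (maxL (x ∷ xs)) (x ∷ xs) in proj₁ r ∷ blocksF f (proj₂ r)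

blocks : List ℕ → List (List ℕ)
blocks w = blocksF (length w) w

b : List ℕ → ℕ
b π with splitAt1 π
... | (πL , [])    = length (blocks πL)
... | (πL , _ ∷ _) = suc (length (blocks πL))

stirling1 : ℕ → ℕ → ℕ
stirling1 zero    zero    = 1
stirling1 zero    (suc k) = 0
stirling1 (suc n) zero    = 0
stirling1 (suc n) (suc k) = n * stirling1 n (suc k) + stirling1 n k

countB : ℕ → ℕ → ℕ
countB n k = length (filter (λ π → b π ≟ k) (perms n))

module Submission where

-- The blocks of a word end exactly at its right-to-left maxima, so prepending a letter adds a block
-- if the letter exceeds everything after it and changes nothing otherwise. Listing the arrangements
-- of an s-letter alphabet by their first letter, the number of blocks therefore satisfies the
-- Stirling recurrence c(s,k) = c(s-1,k-1) + (s-1) c(s-1,k), with the largest letter as pivot; the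
-- same recurrence, with pivot 1, holds for one plus the number of blocks after the letter 1.
-- The involution π_L·1·π_R ↦ π_R·1·π_L of S_n carries b to "blocks of the part after 1, plus one
-- unless the word starts with 1". Split by the first letter, this is the block count of the rest
-- when the first letter is 1 and the second statistic above otherwise, so each of the n possible
-- first letters contributes c(n-1,k).

open import Defs
open import Data.Bool using (true; false)
open import Data.Empty using (⊥-elim)
open import Data.List using (List; []; _∷_; [_]; _++_; map; concatMap; filter; length; upTo)
open import Data.List.Properties
  using (filter-++; filter-accept; filter-reject; filter-all; filter-none; filter-≐;
         length-++; length-map; length-upTo;
         map-cong; map-∘; map-id-local; concatMap-cong; ∷-injectiveˡ; ∷-injectiveʳ)
open import Data.List.Relation.Unary.All as All using (All; []; _∷_)
import Data.List.Relation.Unary.All.Properties as All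
open import Data.List.Relation.Unary.AllPairs as AllPairs using ([]; _∷_)
import Data.List.Relation.Unary.AllPairs.Properties as AllPairs
open import Data.List.Relation.Unary.Any using (here; there)
open import Data.List.Membership.Propositional using (_∈_; _∉_; find; lose)
open import Data.List.Membership.Propositional.Properties
  using (∈-map⁺; ∈-map⁻; ∈-filter⁺; ∈-filter⁻; ∈-concatMap⁺; ∈-concatMap⁻)
open import Data.List.Membership.Propositional.Properties.WithK using (unique∧set⇒bag)
open import Data.List.Relation.Unary.Unique.Propositional using (Unique)
import Data.List.Relation.Unary.Unique.Propositional.Properties as Unique
open import Data.List.Relation.Binary.Disjoint.Propositional using (Disjoint)
open import Data.List.Relation.Binary.BagAndSetEquality using (∼bag⇒↭)
open import Data.List.Relation.Binary.Permutation.Propositional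
  using (_↭_; ↭-refl; ↭-prep; ↭-swap; ↭-sym; ↭-trans; ↭⇒↭ₛ; module PermutationReasoning)
open import Data.List.Relation.Binary.Permutation.Propositional.Properties
  using (↭-length; ↭-empty-inv; ∈-resp-↭; drop-∷; shift; ++-comm; map⁺; filter-↭)
open import Data.Nat using (ℕ; zero; suc; z≤n; s≤s; _+_; _*_; _∸_; _≤_; _<_; _≟_)
open import Data.Nat.ListAction using (sum)
open import Data.Nat.ListAction.Properties using (sum-↭)
open import Data.Nat.Properties
  using (≤-refl; ≤-trans; <⇒≤; <⇒≢; ≤∧≢⇒<; <-≤-trans; n≤1+n; m≤n⇒m≤1+n;
         +-comm; *-zeroʳ; suc-injective;
         m≤m⊔n; m≤n⊔m; ⊔-lub; ⊔-sel; ⊔-identityʳ; m≥n⇒m⊔n≡m; m≤n⇒m⊔n≡n)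
open import Data.Product using (_×_; _,_; proj₁; proj₂; swap)
open import Data.Sum using (inj₁; inj₂)
open import Function using (_∘_)
open import Function.Bundles using (mk⇔)
open import Relation.Binary.PropositionalEquality
  using (_≡_; _≢_; refl; sym; trans; cong; cong₂; subst; setoid; module ≡-Reasoning)
open import Relation.Nullary using (yes; no; ¬_; ¬?; does)
open import Relation.Unary using (Decidable)

open import Data.List.Relation.Unary.Unique.DecPropositional _≟_ using (unique?)
open import Data.List.Relation.Binary.Permutation.Setoid.Properties (setoid ℕ) using (Unique-resp-↭)

countBy : {A : Set} → (A → ℕ) → ℕ → List A → ℕ
countBy f k xs = length (filter (λ x → f x ≟ k) xs)

module _ {A B : Set} {P : B → Set} (P? : Decidable P) where

  filter-map : (f : A → B) (xs : List A) → filter P? (map f xs) ≡ map f (filter (P? ∘ f) xs)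
  filter-map f []       = refl
  filter-map f (x ∷ xs) with does (P? (f x))
  ... | true  = cong (f x ∷_) (filter-map f xs)
  ... | false = filter-map f xs

  filter-concatMap : (f : A → List B) (xs : List A) → filter P? (concatMap f xs) ≡ concatMap (filter P? ∘ f) xs
  filter-concatMap f []       = refl
  filter-concatMap f (x ∷ xs) =
    trans (filter-++ P? (f x) (concatMap f xs)) (cong (filter P? (f x) ++_) (filter-concatMap f xs))

module _ {A : Set} (f : A → ℕ) where

  countBy-concatMap : ∀ k {B : Set} (g : B → List A) (ys : List B) →
                      countBy f k (concatMap g ys) ≡ sum (map (countBy f k ∘ g) ys)
  countBy-concatMap k g []       = refl
  countBy-concatMap k g (y ∷ ys) = begin
    length (filter _ (g y ++ concatMap g ys))             ≡⟨ cong length (filter-++ _ (g y) (concatMap g ys)) ⟩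
    length (filter _ (g y) ++ filter _ (concatMap g ys))  ≡⟨ length-++ (filter _ (g y)) ⟩
    countBy f k (g y) + countBy f k (concatMap g ys)      ≡⟨ cong (countBy f k (g y) +_) (countBy-concatMap k g ys) ⟩
    sum (map (countBy f k ∘ g) (y ∷ ys))                  ∎
    where open ≡-Reasoning

  countBy-map : ∀ k {B : Set} (g : B → A) (ys : List B) → countBy f k (map g ys) ≡ countBy (f ∘ g) k ys
  countBy-map k g ys =
    trans (cong length (filter-map _ g ys)) (length-map g (filter (λ y → f (g y) ≟ k) ys))

  countBy-↭ : ∀ k {xs ys} → xs ↭ ys → countBy f k xs ≡ countBy f k ys
  countBy-↭ k p = ↭-length (filter-↭ _ p)

  countBy-suc : ∀ k xs → countBy (suc ∘ f) (suc k) xs ≡ countBy f k xs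
  countBy-suc k []       = refl
  countBy-suc k (x ∷ xs) with does (f x ≟ k)
  ... | true  = cong suc (countBy-suc k xs)
  ... | false = countBy-suc k xs

  countBy-suc-zero : ∀ xs → countBy (suc ∘ f) zero xs ≡ 0
  countBy-suc-zero []       = refl
  countBy-suc-zero (x ∷ xs) = countBy-suc-zero xs

countBy-cong : {A : Set} {f g : A → ℕ} {k : ℕ} {xs : List A} →
               (∀ {x} → x ∈ xs → f x ≡ g x) → countBy f k xs ≡ countBy g k xs
countBy-cong {xs = []}     _   = refl
countBy-cong {f = f} {g} {k} {x ∷ xs} f≗g with f x | f≗g (here refl)
... | _ | refl with does (g x ≟ k)
...   | true  = cong suc (countBy-cong (f≗g ∘ there))
...   | false = countBy-cong (f≗g ∘ there)

sum-map-const : {A : Set} {f : A → ℕ} {c : ℕ} (xs : List A) →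
                (∀ {x} → x ∈ xs → f x ≡ c) → sum (map f xs) ≡ length xs * c
sum-map-const []       _   = refl
sum-map-const (x ∷ xs) f≡c = cong₂ _+_ (f≡c (here refl)) (sum-map-const xs (f≡c ∘ there))

involution-↭ : {A : Set} {f : A → A} {xs : List A} → Unique xs →
               (∀ {x} → x ∈ xs → f x ∈ xs) → (∀ {x} → x ∈ xs → f (f x) ≡ x) → map f xs ↭ xs
involution-↭ {f = f} {xs} uxs closed involutive =
  ∼bag⇒↭ (unique∧set⇒bag (Unique.map⁻ (subst Unique (sym map-f-twice) uxs)) uxs (mk⇔ to from))
  where
  map-f-twice : map f (map f xs) ≡ xs
  map-f-twice = trans (sym (map-∘ xs)) (map-id-local (All.tabulate involutive))
  to : ∀ {x} → x ∈ map f xs → x ∈ xs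
  to x∈ with _ , y∈ , refl ← ∈-map⁻ f x∈ = closed y∈
  from : ∀ {x} → x ∈ xs → x ∈ map f xs
  from x∈ = subst (_∈ map f xs) (involutive x∈) (∈-map⁺ f (closed x∈))

-- Arrangements of an alphabet

remove : ℕ → List ℕ → List ℕ
remove x = filter (¬? ∘ (x ≟_))

∈-remove⁺ : ∀ {x y S} → y ∈ S → x ≢ y → y ∈ remove x S
∈-remove⁺ {x} = ∈-filter⁺ (¬? ∘ (x ≟_))

∈-remove⁻ : ∀ {x y} S → y ∈ remove x S → y ∈ S × x ≢ y
∈-remove⁻ {x} S = ∈-filter⁻ (¬? ∘ (x ≟_)) {xs = S}

unique-remove : ∀ x {S} → Unique S → Unique (remove x S)
unique-remove x = Unique.filter⁺ (¬? ∘ (x ≟_))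

↭-remove : ∀ {x S} → Unique S → x ∈ S → S ↭ x ∷ remove x S
↭-remove {x} {x ∷ S} (x∉S ∷ _) (here refl) = begin
  x ∷ S                 ≡⟨ cong (x ∷_) (filter-all (¬? ∘ (x ≟_)) x∉S) ⟨
  x ∷ remove x S        ≡⟨ cong (x ∷_) (filter-reject (¬? ∘ (x ≟_)) (λ x≢x → x≢x refl)) ⟨
  x ∷ remove x (x ∷ S)  ∎
  where open PermutationReasoning
↭-remove {x} {y ∷ S} (y∉S ∷ uS) (there x∈S) = begin
  y ∷ S                 ↭⟨ ↭-prep y (↭-remove uS x∈S) ⟩
  y ∷ x ∷ remove x S    ↭⟨ ↭-swap y x ↭-refl ⟩
  x ∷ y ∷ remove x S    ≡⟨ cong (x ∷_) (filter-accept (¬? ∘ (x ≟_)) x≢y) ⟨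
  x ∷ remove x (y ∷ S)  ∎
  where
  open PermutationReasoning
  x≢y : x ≢ y
  x≢y x≡y = All.lookup y∉S x∈S (sym x≡y)

length-remove : ∀ {x S s} → Unique S → x ∈ S → length S ≡ suc s → length (remove x S) ≡ s
length-remove uS x∈S |S|≡1+s = suc-injective (trans (sym (↭-length (↭-remove uS x∈S))) |S|≡1+s)

sum-map-pivot : ∀ {f : ℕ → ℕ} {c B S} → Unique S → c ∈ S → (∀ {y} → y ∈ remove c S → f y ≡ B) →
                sum (map f S) ≡ f c + length (remove c S) * B
sum-map-pivot {f} {c} {S = S} uS c∈S f≡B =
  trans (sum-↭ (map⁺ f (↭-remove uS c∈S))) (cong (f c +_) (sum-map-const (remove c S) f≡B))

wordsOver : List ℕ → ℕ → List (List ℕ)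
wordsOver S zero    = [ [] ]
wordsOver S (suc m) = concatMap (λ x → map (x ∷_) (wordsOver S m)) S

words≡wordsOver : ∀ n m → words n m ≡ wordsOver (letters n) m
words≡wordsOver n zero    = refl
words≡wordsOver n (suc m) =
  cong (λ ws → concatMap (λ x → map (x ∷_) ws) (letters n)) (words≡wordsOver n m)

arrangements : List ℕ → ℕ → List (List ℕ)
arrangements S zero    = [ [] ]
arrangements S (suc m) = concatMap (λ x → map (x ∷_) (arrangements (remove x S) m)) S

-- Written with all? exactly as unique? (x ∷ w) is, so that the latter unfolds to
-- avoids? x w and unique? w (see filter-unique-∷).
avoids? : (x : ℕ) → Decidable (All (x ≢_))
avoids? x = All.all? (¬? ∘ (x ≟_))

filter-avoids-wordsOver : ∀ x S m → filter (avoids? x) (wordsOver S m) ≡ wordsOver (remove x S) m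
filter-avoids-wordsOver x S zero    = refl
filter-avoids-wordsOver x S (suc m) = begin
  filter (avoids? x) (concatMap (λ y → map (y ∷_) ws) S)  ≡⟨ filter-concatMap (avoids? x) _ S ⟩
  concatMap filtered S                                   ≡⟨ xBlockVanishes S ⟩
  concatMap prefixed (remove x S)                        ≡⟨ cong (λ vs → concatMap (λ y → map (y ∷_) vs) (remove x S))
                                                                 (filter-avoids-wordsOver x S m) ⟩
  wordsOver (remove x S) (suc m)                         ∎
  where
  open ≡-Reasoning
  ws = wordsOver S m
  filtered prefixed : ℕ → List (List ℕ)
  filtered y = filter (avoids? x) (map (y ∷_) ws)
  prefixed y = map (y ∷_) (filter (avoids? x) ws)

  xBlockVanishes : ∀ T → concatMap filtered T ≡ concatMap prefixed (remove x T)
  xBlockVanishes []      = refl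
  xBlockVanishes (y ∷ T) with x ≟ y
  ... | yes refl = begin
    filtered x ++ concatMap filtered T     ≡⟨ cong (_++ concatMap filtered T) (filter-none (avoids? x) noneAvoid) ⟩
    concatMap filtered T                   ≡⟨ xBlockVanishes T ⟩
    concatMap prefixed (remove x T)        ≡⟨ cong (concatMap prefixed) (filter-reject (¬? ∘ (x ≟_)) x≢x-absurd) ⟨
    concatMap prefixed (remove x (x ∷ T))  ∎
    where
    x≢x-absurd : ¬ x ≢ x
    x≢x-absurd x≢x = x≢x refl
    noneAvoid : All (λ w → ¬ All (x ≢_) w) (map (x ∷_) ws)
    noneAvoid = All.map⁺ (All.universal (λ { _ (x≢x ∷ _) → x≢x refl }) ws)
  ... | no x≢y = begin
    filtered y ++ concatMap filtered T     ≡⟨ cong (_++ concatMap filtered T) (filter-map (avoids? x) (y ∷_) ws) ⟩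
    map (y ∷_) (filter (avoids? x ∘ (y ∷_)) ws) ++ concatMap filtered T
                                           ≡⟨ cong₂ (λ vs us → map (y ∷_) vs ++ us) avoidsTail (xBlockVanishes T) ⟩
    concatMap prefixed (y ∷ remove x T)    ≡⟨ cong (concatMap prefixed) (filter-accept (¬? ∘ (x ≟_)) x≢y) ⟨
    concatMap prefixed (remove x (y ∷ T))  ∎
    where
    avoidsTail : filter (avoids? x ∘ (y ∷_)) ws ≡ filter (avoids? x) ws
    avoidsTail = filter-≐ _ (avoids? x) ((λ { (_ ∷ a) → a }) , (x≢y ∷_)) ws

filter-unique-∷ : ∀ x ws → filter (unique? ∘ (x ∷_)) ws ≡ filter unique? (filter (avoids? x) ws)
filter-unique-∷ x []       = refl
filter-unique-∷ x (w ∷ ws) with does (avoids? x w)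
... | false = filter-unique-∷ x ws
... | true with does (unique? w)
...   | true  = cong (w ∷_) (filter-unique-∷ x ws)
...   | false = filter-unique-∷ x ws

filter-unique-wordsOver : ∀ S m → filter unique? (wordsOver S m) ≡ arrangements S m
filter-unique-wordsOver S zero    = refl
filter-unique-wordsOver S (suc m) = trans (filter-concatMap unique? _ S) (concatMap-cong byFirst S)
  where
  byFirst : ∀ x → filter unique? (map (x ∷_) (wordsOver S m)) ≡ map (x ∷_) (arrangements (remove x S) m)
  byFirst x = begin
    filter unique? (map (x ∷_) ws)                ≡⟨ filter-map unique? (x ∷_) ws ⟩
    map (x ∷_) (filter (unique? ∘ (x ∷_)) ws)     ≡⟨ cong (map (x ∷_)) (filter-unique-∷ x ws) ⟩
    map (x ∷_) (filter unique? (filter (avoids? x) ws))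
                                                  ≡⟨ cong (map (x ∷_) ∘ filter unique?) (filter-avoids-wordsOver x S m) ⟩
    map (x ∷_) (filter unique? (wordsOver (remove x S) m))
                                                  ≡⟨ cong (map (x ∷_)) (filter-unique-wordsOver (remove x S) m) ⟩
    map (x ∷_) (arrangements (remove x S) m)      ∎
    where
    open ≡-Reasoning
    ws = wordsOver S m

perms≡arrangements : ∀ n → perms n ≡ arrangements (letters n) n
perms≡arrangements n =
  trans (cong (filter unique?) (words≡wordsOver n n)) (filter-unique-wordsOver (letters n) n)

∈-arrangements⁻ : ∀ {S m w} → Unique S → length S ≡ m → w ∈ arrangements S m → w ↭ S
∈-arrangements⁻ {[]} {zero}  _  _   (here refl) = ↭-refl
∈-arrangements⁻ {S}  {suc m} uS |S| w∈
  with x , x∈S , w∈x∷ ← find (∈-concatMap⁻ (λ x → map (x ∷_) (arrangements (remove x S) m)) {xs = S} w∈)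
  with v , v∈ , refl ← ∈-map⁻ (x ∷_) w∈x∷ = begin
  x ∷ v           ↭⟨ ↭-prep x (∈-arrangements⁻ (unique-remove x uS) (length-remove uS x∈S |S|) v∈) ⟩
  x ∷ remove x S  ↭⟨ ↭-remove uS x∈S ⟨
  S               ∎
  where open PermutationReasoning

∈-arrangements⁺ : ∀ {S m w} → Unique S → length S ≡ m → w ↭ S → w ∈ arrangements S m
∈-arrangements⁺ {[]} {zero}          _  _   w↭[] rewrite ↭-empty-inv w↭[] = here refl
∈-arrangements⁺ {S}  {suc m} {[]}    _  |S| []↭S with () ← trans (↭-length []↭S) |S|
∈-arrangements⁺ {S}  {suc m} {x ∷ v} uS |S| x∷v↭S =
  ∈-concatMap⁺ (λ y → map (y ∷_) (arrangements (remove y S) m)) (lose x∈S (∈-map⁺ (x ∷_) v∈))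
  where
  x∈S : x ∈ S
  x∈S = ∈-resp-↭ x∷v↭S (here refl)
  v↭ : v ↭ remove x S
  v↭ = drop-∷ (↭-trans x∷v↭S (↭-remove uS x∈S))
  v∈ : v ∈ arrangements (remove x S) m
  v∈ = ∈-arrangements⁺ (unique-remove x uS) (length-remove uS x∈S |S|) v↭

arrangements-unique : ∀ {S} m → Unique S → Unique (arrangements S m)
arrangements-unique         zero    _  = [] ∷ []
arrangements-unique {S} (suc m) uS =
  Unique.concat⁺ (All.map⁺ (All.universal uniqueByFirst S)) (AllPairs.map⁺ (AllPairs.map headsDiffer uS))
  where
  uniqueByFirst : ∀ x → Unique (map (x ∷_) (arrangements (remove x S) m))
  uniqueByFirst x = Unique.map⁺ ∷-injectiveʳ (arrangements-unique m (unique-remove x uS))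
  headsDiffer : ∀ {x y} {vs ws : List (List ℕ)} → x ≢ y → Disjoint (map (x ∷_) vs) (map (y ∷_) ws)
  headsDiffer x≢y (v∈ , v∈′) with ∈-map⁻ _ v∈ | ∈-map⁻ _ v∈′
  ... | _ , _ , refl | _ , _ , eq = x≢y (∷-injectiveˡ eq)

countBy-arrangements-suc : ∀ (f : List ℕ → ℕ) k S m → countBy f k (arrangements S (suc m))
                         ≡ sum (map (λ x → countBy (f ∘ (x ∷_)) k (arrangements (remove x S) m)) S)
countBy-arrangements-suc f k S m = trans (countBy-concatMap f k _ S) (cong sum (map-cong byFirst S))
  where
  byFirst : ∀ x → countBy f k (map (x ∷_) (arrangements (remove x S) m))
                 ≡ countBy (f ∘ (x ∷_)) k (arrangements (remove x S) m)
  byFirst x = countBy-map f k (x ∷_) (arrangements (remove x S) m)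

-- Stirling-distributed statistics

StirlingDistributed : ℕ → (List ℕ → ℕ) → List (List ℕ) → Set
StirlingDistributed s f ws = ∀ k → countBy f k ws ≡ stirling1 s k

*-stirling1-zero : ∀ s → s * stirling1 s 0 ≡ 0
*-stirling1-zero zero    = refl
*-stirling1-zero (suc s) = *-zeroʳ (suc s)

stirling-by-pivot : ∀ {S s c} {f g : List ℕ → ℕ} → Unique S → c ∈ S → length S ≡ suc s →
  StirlingDistributed s g (arrangements (remove c S) s) →
  (∀ {w} → w ∈ arrangements (remove c S) s → f (c ∷ w) ≡ suc (g w)) →
  (∀ {y} → y ∈ remove c S → StirlingDistributed s (f ∘ (y ∷_)) (arrangements (remove y S) s)) →
  StirlingDistributed (suc s) f (arrangements S (suc s))
stirling-by-pivot {S} {s} {c} {f} {g} uS c∈S |S| g-stirling f≡suc∘g others k = begin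
  countBy f k (arrangements S (suc s))             ≡⟨ countBy-arrangements-suc f k S s ⟩
  sum (map byFirst S)                              ≡⟨ sum-map-pivot uS c∈S (λ y∈ → others y∈ k) ⟩
  byFirst c + length (remove c S) * stirling1 s k  ≡⟨ cong₂ (λ a l → a + l * stirling1 s k)
                                                           (countBy-cong f≡suc∘g) (length-remove uS c∈S |S|) ⟩
  countBy (suc ∘ g) k rest + s * stirling1 s k     ≡⟨ recurrence k ⟩
  stirling1 (suc s) k                              ∎
  where
  open ≡-Reasoning
  rest = arrangements (remove c S) s
  byFirst : ℕ → ℕ
  byFirst x = countBy (f ∘ (x ∷_)) k (arrangements (remove x S) s)
  recurrence : ∀ k → countBy (suc ∘ g) k rest + s * stirling1 s k ≡ stirling1 (suc s) k
  recurrence zero    = trans (cong (_+ s * stirling1 s 0) (countBy-suc-zero g rest)) (*-stirling1-zero s)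
  recurrence (suc k) = trans (cong (_+ s * stirling1 s (suc k)) (trans (countBy-suc g k rest) (g-stirling k)))
                             (+-comm (stirling1 s k) _)

-- Blocks

≤-maxL : ∀ {y} w → y ∈ w → y ≤ maxL w
≤-maxL (x ∷ w) (here refl) = m≤m⊔n x (maxL w)
≤-maxL (x ∷ w) (there y∈w) = ≤-trans (≤-maxL w y∈w) (m≤n⊔m x (maxL w))

maxL-mono : ∀ v {w} → (∀ {y} → y ∈ v → y ∈ w) → maxL v ≤ maxL w
maxL-mono []      _   = z≤n
maxL-mono (x ∷ v) v⊆w = ⊔-lub (≤-maxL _ (v⊆w (here refl))) (maxL-mono v (v⊆w ∘ there))

maxL-∈ : ∀ x w → maxL (x ∷ w) ∈ x ∷ w
maxL-∈ x []      = here (⊔-identityʳ x)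
maxL-∈ x (y ∷ w) with ⊔-sel x (maxL (y ∷ w))
... | inj₁ x⊔M≡x = here x⊔M≡x
... | inj₂ x⊔M≡M = there (subst (_∈ y ∷ w) (sym x⊔M≡M) (maxL-∈ y w))

splitAfter-self : ∀ x w → splitAfter x (x ∷ w) ≡ ([ x ] , w)
splitAfter-self x w with x ≟ x
... | yes _  = refl
... | no x≢x = ⊥-elim (x≢x refl)

splitAfter-≢ : ∀ {m x} w → x ≢ m →
              splitAfter m (x ∷ w) ≡ (x ∷ proj₁ (splitAfter m w) , proj₂ (splitAfter m w))
splitAfter-≢ {m} {x} w x≢m with x ≟ m
... | yes x≡m = ⊥-elim (x≢m x≡m)
... | no _    = refl

length-splitAfter : ∀ m w → length (proj₂ (splitAfter m w)) ≤ length w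
length-splitAfter m []      = z≤n
length-splitAfter m (x ∷ w) with x ≟ m
... | yes _ = n≤1+n (length w)
... | no _  = m≤n⇒m≤1+n (length-splitAfter m w)

length-splitAfter-∷ : ∀ m x w → length (proj₂ (splitAfter m (x ∷ w))) ≤ length w
length-splitAfter-∷ m x w with x ≟ m
... | yes _ = ≤-refl
... | no _  = length-splitAfter m w

blocksF-suc : ∀ {f} w → length w ≤ f → blocksF (suc f) w ≡ blocksF f w
blocksF-suc {zero}  []      _           = refl
blocksF-suc {suc f} []      _           = refl
blocksF-suc {suc f} (x ∷ w) (s≤s |w|≤f) =
  cong (_ ∷_) (blocksF-suc _ (≤-trans (length-splitAfter-∷ (maxL (x ∷ w)) x w) |w|≤f))

blockCount : List ℕ → ℕ
blockCount w = length (blocks w)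

blocks-∷-max : ∀ {x} w → maxL w ≤ x → blocks (x ∷ w) ≡ [ x ] ∷ blocks w
blocks-∷-max {x} w maxL≤x rewrite m≥n⇒m⊔n≡m maxL≤x | splitAfter-self x w = refl

blockCount-∷-< : ∀ {x} w → x < maxL w → blockCount (x ∷ w) ≡ blockCount w
blockCount-∷-< {x} (y ∷ w) x<M rewrite m≤n⇒m⊔n≡n (<⇒≤ x<M) | splitAfter-≢ (y ∷ w) (<⇒≢ x<M) =
  cong suc (cong length (blocksF-suc _ (length-splitAfter-∷ (maxL (y ∷ w)) y w)))

blockCount-stirling : ∀ {S s} → Unique S → length S ≡ s →
                      StirlingDistributed s blockCount (arrangements S s)
blockCount-stirling {[]}    {zero}  _  _   zero    = refl
blockCount-stirling {[]}    {zero}  _  _   (suc k) = refl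
blockCount-stirling {x ∷ S} {suc s} uS |S| =
  stirling-by-pivot uS M∈S |S| (blockCount-stirling (unique-remove M uS) (length-remove uS M∈S |S|))
                    M-first others
  where
  M : ℕ
  M = maxL (x ∷ S)
  M∈S : M ∈ x ∷ S
  M∈S = maxL-∈ x S

  ↭-rest : ∀ {y w} → y ∈ x ∷ S → w ∈ arrangements (remove y (x ∷ S)) s → w ↭ remove y (x ∷ S)
  ↭-rest {y} y∈S = ∈-arrangements⁻ (unique-remove y uS) (length-remove uS y∈S |S|)

  M-first : ∀ {w} → w ∈ arrangements (remove M (x ∷ S)) s → blockCount (M ∷ w) ≡ suc (blockCount w)
  M-first {w} w∈ =
    cong length (blocks-∷-max w (maxL-mono w (proj₁ ∘ ∈-remove⁻ {M} (x ∷ S) ∘ ∈-resp-↭ (↭-rest M∈S w∈))))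

  others : ∀ {y} → y ∈ remove M (x ∷ S) →
           StirlingDistributed s (blockCount ∘ (y ∷_)) (arrangements (remove y (x ∷ S)) s)
  others {y} y∈ k with y∈S , M≢y ← ∈-remove⁻ {M} (x ∷ S) y∈ =
    trans (countBy-cong (λ {w} w∈ → blockCount-∷-< w (y<maxL w∈)))
          (blockCount-stirling (unique-remove y uS) (length-remove uS y∈S |S|) k)
    where
    y<maxL : ∀ {w} → w ∈ arrangements (remove y (x ∷ S)) s → y < maxL w
    y<maxL {w} w∈ = <-≤-trans (≤∧≢⇒< (≤-maxL _ y∈S) (M≢y ∘ sym))
                              (≤-maxL w (∈-resp-↭ (↭-sym (↭-rest y∈S w∈)) (∈-remove⁺ M∈S (M≢y ∘ sym))))

-- The letter 1

before1 after1 : List ℕ → List ℕ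
before1 = proj₁ ∘ splitAt1
after1  = proj₂ ∘ splitAt1

splitAt1-∷-≢ : ∀ {x} w → x ≢ 1 → splitAt1 (x ∷ w) ≡ (x ∷ before1 w , after1 w)
splitAt1-∷-≢ {x} w x≢1 with x ≟ 1
... | yes x≡1 = ⊥-elim (x≢1 x≡1)
... | no _    = refl

suc∘blockCount∘after1-stirling : ∀ {S s} → Unique S → 1 ∈ S → length S ≡ s →
                                 StirlingDistributed s (suc ∘ blockCount ∘ after1) (arrangements S s)
suc∘blockCount∘after1-stirling {[]}    _ () _
suc∘blockCount∘after1-stirling {_ ∷ _} {zero} _ _ ()
suc∘blockCount∘after1-stirling {S} {suc s} uS 1∈S |S| =
  stirling-by-pivot uS 1∈S |S| (blockCount-stirling (unique-remove 1 uS) (length-remove uS 1∈S |S|))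
                    (λ _ → refl) others
  where
  others : ∀ {y} → y ∈ remove 1 S →
           StirlingDistributed s (suc ∘ blockCount ∘ after1 ∘ (y ∷_)) (arrangements (remove y S) s)
  others {y} y∈ k with y∈S , 1≢y ← ∈-remove⁻ {1} S y∈ =
    trans (countBy-cong {xs = rest} (λ {w} _ → cong (suc ∘ blockCount ∘ proj₂) (splitAt1-∷-≢ w y≢1)))
          (suc∘blockCount∘after1-stirling (unique-remove y uS) (∈-remove⁺ 1∈S y≢1) (length-remove uS y∈S |S|) k)
    where
    y≢1 : y ≢ 1
    y≢1 = 1≢y ∘ sym
    rest = arrangements (remove y S) s

bOf : List ℕ × List ℕ → ℕ
bOf (L , [])    = blockCount L
bOf (L , _ ∷ _) = suc (blockCount L)

b≡bOf∘splitAt1 : ∀ π → b π ≡ bOf (splitAt1 π)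
b≡bOf∘splitAt1 π with splitAt1 π
... | (L , [])    = refl
... | (L , _ ∷ _) = refl

countBy-bOf∘swap : ∀ {S s} → Unique S → 1 ∈ S → length S ≡ suc s →
                   ∀ k → countBy (bOf ∘ swap ∘ splitAt1) k (arrangements S (suc s)) ≡ suc s * stirling1 s k
countBy-bOf∘swap {S} {s} uS 1∈S |S| k =
  trans (countBy-arrangements-suc _ k S s) (trans (sum-map-const S byFirst) (cong (_* stirling1 s k) |S|))
  where
  byFirst : ∀ {x} → x ∈ S →
            countBy (bOf ∘ swap ∘ splitAt1 ∘ (x ∷_)) k (arrangements (remove x S) s) ≡ stirling1 s k
  byFirst {x} x∈S with x ≟ 1
  ... | yes refl = blockCount-stirling (unique-remove 1 uS) (length-remove uS 1∈S |S|) k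
  ... | no x≢1   = suc∘blockCount∘after1-stirling (unique-remove x uS) (∈-remove⁺ {x} 1∈S x≢1)
                                                  (length-remove uS x∈S |S|) k

swapAround1 : List ℕ → List ℕ
swapAround1 σ = after1 σ ++ 1 ∷ before1 σ

splitAt1-++ : ∀ {L} R → 1 ∉ L → splitAt1 (L ++ 1 ∷ R) ≡ (L , R)
splitAt1-++ {[]}    R _  = refl
splitAt1-++ {x ∷ L} R 1∉ = trans (splitAt1-∷-≢ (L ++ 1 ∷ R) (λ x≡1 → 1∉ (here (sym x≡1))))
                                 (cong (λ p → x ∷ proj₁ p , proj₂ p) (splitAt1-++ R (1∉ ∘ there)))

before1++1∷after1 : ∀ {σ} → 1 ∈ σ → before1 σ ++ 1 ∷ after1 σ ≡ σ
before1++1∷after1 {x ∷ σ} 1∈ with x ≟ 1 | 1∈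
... | yes refl | _         = refl
... | no x≢1   | here 1≡x  = ⊥-elim (x≢1 (sym 1≡x))
... | no _     | there 1∈σ = cong (x ∷_) (before1++1∷after1 1∈σ)

1∉after1 : ∀ {σ} → Unique σ → 1 ∉ after1 σ
1∉after1 {x ∷ σ} (x∉σ ∷ uσ) with x ≟ 1
... | yes refl = λ 1∈σ → All.lookup x∉σ 1∈σ refl
... | no _     = 1∉after1 uσ

splitAt1-swapAround1 : ∀ {σ} → Unique σ → splitAt1 (swapAround1 σ) ≡ swap (splitAt1 σ)
splitAt1-swapAround1 {σ} uσ = splitAt1-++ (before1 σ) (1∉after1 uσ)

swapAround1-involutive : ∀ {σ} → Unique σ → 1 ∈ σ → swapAround1 (swapAround1 σ) ≡ σ
swapAround1-involutive uσ 1∈σ =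
  trans (cong (λ p → proj₂ p ++ 1 ∷ proj₁ p) (splitAt1-swapAround1 uσ)) (before1++1∷after1 1∈σ)

swapAround1-↭ : ∀ {σ} → 1 ∈ σ → swapAround1 σ ↭ σ
swapAround1-↭ {σ} 1∈σ = begin
  after1 σ ++ 1 ∷ before1 σ  ↭⟨ ++-comm (after1 σ) (1 ∷ before1 σ) ⟩
  1 ∷ before1 σ ++ after1 σ  ↭⟨ shift 1 (before1 σ) (after1 σ) ⟨
  before1 σ ++ 1 ∷ after1 σ  ≡⟨ before1++1∷after1 1∈σ ⟩
  σ                          ∎
  where open PermutationReasoning

b∘swapAround1 : ∀ {σ} → Unique σ → b (swapAround1 σ) ≡ bOf (swap (splitAt1 σ))
b∘swapAround1 {σ} uσ = trans (b≡bOf∘splitAt1 (swapAround1 σ)) (cong bOf (splitAt1-swapAround1 uσ))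

countBy-b≡countBy-bOf∘swap : ∀ {S n} → Unique S → 1 ∈ S → length S ≡ n →
  ∀ k → countBy b k (arrangements S n) ≡ countBy (bOf ∘ swap ∘ splitAt1) k (arrangements S n)
countBy-b≡countBy-bOf∘swap {S} {n} uS 1∈S |S| k = begin
  countBy b k σs                        ≡⟨ countBy-↭ b k (↭-sym swapAround1-permutes) ⟩
  countBy b k (map swapAround1 σs)      ≡⟨ countBy-map b k swapAround1 σs ⟩
  countBy (b ∘ swapAround1) k σs        ≡⟨ countBy-cong (b∘swapAround1 ∘ unique) ⟩
  countBy (bOf ∘ swap ∘ splitAt1) k σs  ∎
  where
  open ≡-Reasoning
  σs = arrangements S n
  S↭ : ∀ {σ} → σ ∈ σs → S ↭ σ
  S↭ = ↭-sym ∘ ∈-arrangements⁻ uS |S|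
  unique : ∀ {σ} → σ ∈ σs → Unique σ
  unique σ∈ = Unique-resp-↭ (↭⇒↭ₛ (S↭ σ∈)) uS
  1∈ : ∀ {σ} → σ ∈ σs → 1 ∈ σ
  1∈ σ∈ = ∈-resp-↭ (S↭ σ∈) 1∈S
  closed : ∀ {σ} → σ ∈ σs → swapAround1 σ ∈ σs
  closed σ∈ = ∈-arrangements⁺ uS |S| (↭-trans (swapAround1-↭ (1∈ σ∈)) (↭-sym (S↭ σ∈)))
  involutive : ∀ {σ} → σ ∈ σs → swapAround1 (swapAround1 σ) ≡ σ
  involutive σ∈ = swapAround1-involutive (unique σ∈) (1∈ σ∈)
  swapAround1-permutes : map swapAround1 σs ↭ σs
  swapAround1-permutes = involution-↭ (arrangements-unique n uS) closed involutive

countBy-b-arrangements : ∀ {S s} → Unique S → 1 ∈ S → length S ≡ suc s →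
  ∀ k → countBy b k (arrangements S (suc s)) ≡ suc s * stirling1 s k
countBy-b-arrangements uS 1∈S |S| k =
  trans (countBy-b≡countBy-bOf∘swap uS 1∈S |S| k) (countBy-bOf∘swap uS 1∈S |S| k)

theorem4p3 : (n k : ℕ) → 1 ≤ n → countB n k ≡ n * stirling1 (n ∸ 1) k
theorem4p3 zero    k ()
theorem4p3 (suc s) k _ = begin
  countB (suc s) k                          ≡⟨ cong (countBy b k) (perms≡arrangements (suc s)) ⟩
  countBy b k (arrangements S (suc s))      ≡⟨ countBy-b-arrangements unique-letters 1∈letters length-letters k ⟩
  suc s * stirling1 s k                     ∎
  where
  open ≡-Reasoning
  S = letters (suc s)
  unique-letters : Unique S
  unique-letters = Unique.map⁺ suc-injective (Unique.upTo⁺ (suc s))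
  1∈letters : 1 ∈ S
  1∈letters = here refl
  length-letters : length S ≡ suc s
  length-letters = trans (length-map suc (upTo (suc s))) (length-upTo (suc s))
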